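{- Under the response strategy $RS_2$ described in the context, every element of $E_n$ is essential.
   Context: Let $n\ge1$ and let $A_n=(a_1,\dots,a_n)$ be distinct reals with $a_i<a_j$ whenever $i\ne j$, $i\mid j$. A search algorithm compares a real $x$ adaptively with entries $a_k$; each comparison $x:a_k$ is answered by an adversary with $x<a_k$, $x=a_k$ or $x>a_k$. Layers: for each $i\le n$ divisible by neither 2 nor 3, $L_i=\{a_{i2^k3^s}:k,s\ge0,\ i2^k3^s\le n\}$, with $a_{i2^k3^s}$ in row $s$ and column $k$; each nonempty row $s$ is $a_{i3^s},a_{2i3^s},a_{4i3^s},\dots$ in increasing order of $k$. The layers partition $A_n$. Units: in each nonempty row of each layer, the unit of the row is the set of all its elements if the row has fewer than four elements, and its last four elements (largest $k$) otherwise; a unit with $t$ elements is a $t$-unit, and its elements are called first, second, ... in increasing order of $k$ (so a unit with first element $a_k$ is $\{a_k,a_{2k},\dots\}$). An element $a_k$ lies in no unit iff $16k\le n$. A 3-unit is a 3-unit$_1$ if the next row below it in its layer has exactly one element, and a 3-unit$_2$ if that row has exactly two elements. A special unit (4-unit$_s$) is the 4-unit of a layer $L_i$ with $|L_i|=9$ (equivalently $n/18<i\le n/16$, $i$ divisible by neither 2 nor 3); it is $\{a_{2i},a_{4i},a_{8i},a_{16i}\}$. All other 4-units are general 4-units (4-unit$_g$). Response strategy $RS_2$: for $a_k$ in no unit, answer $x>a_k$. For a 1-unit $\{a_k\}$: $x<a_k$. For a 2-unit $\{a_k,a_{2k}\}$: $x>a_k$, $x<a_{2k}$. For a 3-unit$_1$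 $\{a_k,a_{2k},a_{4k}\}$: $x>a_k$, $x<a_{2k}$, $x<a_{4k}$. For a 3-unit$_2$ $\{a_k,a_{2k},a_{4k}\}$: $x>a_k$, $x>a_{2k}$, $x<a_{4k}$. For a 4-unit$_g$ $\{a_k,a_{2k},a_{4k},a_{8k}\}$: $x>a_k$, $x>a_{2k}$, $x<a_{4k}$, $x<a_{8k}$. For a special unit $\{e_1,e_2,e_3,e_4\}=\{a_{2i},a_{4i},a_{8i},a_{16i}\}$ the answers are adaptive, depending on which of its elements is queried first: if $e_1$ first: $x>e_1$, and later $x>e_2$, $x<e_3$, $x<e_4$; if $e_2$ first: $x>e_2$, and later $x>e_1$, $x>e_3$, $x<e_4$; if $e_3$ first: $x<e_3$, and later $x>e_1$, $x<e_2$, $x<e_4$; if $e_4$ first: $x<e_4$, and later $x>e_1$, $x>e_2$, $x<e_3$. Cutting: if the answer to $x:a_k$ is $x<a_k$, then $a_k$ cuts every $a_m$ with $m\ne k$, $k\mid m$; if the answer is $x>a_k$, then $a_k$ cuts every $a_m$ with $m\neq k$, $m\mid k$. An element $a_m$ is essential under the strategy if $a_m$ belongs to some unit $u$ and no element $a_k\notin u$ cuts $a_m$ under any answer the strategy may give to the comparison $x:a_k$. $E_n$ is the union of: all elements of 1-units; all elements of 2-units; the first and second elements of all 3-unit$_1$'s; the second and third elements of all 3-unit$_2$'s; the second and third elements of all 4-unit$_g$'s; all elements of all special units. -}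

module Defs where

open import Data.Nat using (ℕ; zero; suc; _+_; _*_; _^_; _≤_; _<_)
open import Data.Nat.Divisibility using (_∣_)
open import Data.Fin using (Fin; toℕ) renaming (zero to f0; suc to fs)
open import Data.Product using (Σ; ∃; ∃-syntax; _×_; _,_)
open import Data.Sum using (_⊎_)
open import Data.Empty using (⊥)
open import Data.Unit using (⊤)
open import Relation.Nullary using (¬_)
open import Relation.Binary.PropositionalEquality using (_≡_; _≢_)

-- The array A_n = (a_1,…,a_n) is represented by its indices: element a_k is
-- identified with k ∈ {1,…,n}.  Only the divisibility order matters.

data Ans : Set where
  lt eq gt : Ans     -- x < a_k , x = a_k , x > a_k

Cuts : ℕ → Ans → ℕ → Set
Cuts k lt m = (k ∣ m) × (m ≢ k)
Cuts k eq m = ⊥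
Cuts k gt m = (m ∣ k) × (m ≢ k)

-- Rows / units.
-- A row of a layer L_i is {r·2^j ≤ n} with r = i·3^s odd; its unit is its
-- last min(4, length) elements, i.e. exactly the row elements k with 16k > n.

Odd : ℕ → Set
Odd r = ¬ (2 ∣ r)

InSomeUnit : ℕ → ℕ → Set
InSomeUnit n k = (1 ≤ k) × (k ≤ n) × (n < 16 * k)

-- f is the first element of a unit: f lies in a unit and f is either the
-- first element of its row (odd) or its row-predecessor f/2 lies in no unit
-- (16·(f/2) ≤ n, i.e. 8f ≤ n).
UnitHead : ℕ → ℕ → Set
UnitHead n f = InSomeUnit n f × (Odd f ⊎ 8 * f ≤ n)

-- the unit with first element f is {f·2^p : p < 4, f·2^p ≤ n};
-- its p-th element (0-based, p = 0 is "first")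
elem : ℕ → Fin 4 → ℕ
elem f p = f * 2 ^ toℕ p

InUnitOf : ℕ → ℕ → ℕ → Set
InUnitOf n f k = (k ≤ n) × ∃[ p ] (k ≡ elem f p)

SpecialHead : ℕ → ℕ → Set
SpecialHead n f = ∃[ i ] ((f ≡ 2 * i) × ¬ (2 ∣ i) × ¬ (3 ∣ i) × (n < 18 * i) × (16 * i ≤ n))

data UType : Set where
  u1 u2 u3₁ u3₂ u4g u4s : UType

-- A 3-unit has odd head f (its row is {f,2f,4f}), so the next row below it in
-- its layer is {3f·2^j ≤ n}: exactly one element iff 3f ≤ n < 6f,
-- exactly two elements iff 6f ≤ n < 12f.
HeadType : ℕ → ℕ → UType → Set
HeadType n f u1  = n < 2 * f
HeadType n f u2  = (2 * f ≤ n) × (n < 4 * f)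
HeadType n f u3₁ = (4 * f ≤ n) × (n < 8 * f) × (3 * f ≤ n) × (n < 6 * f)
HeadType n f u3₂ = (4 * f ≤ n) × (n < 8 * f) × (6 * f ≤ n) × (n < 12 * f)
HeadType n f u4g = (8 * f ≤ n) × ¬ SpecialHead n f
HeadType n f u4s = (8 * f ≤ n) × SpecialHead n f

-- Special unit: answer to element q when element `first` was queried first
-- (if q is itself the first queried element, the answer is specialAns q q).
specialAns : Fin 4 → Fin 4 → Ans
specialAns f0 f0 = gt
specialAns f0 (fs f0) = gt
specialAns f0 (fs (fs f0)) = lt
specialAns f0 (fs (fs (fs f0))) = lt
specialAns (fs f0) f0 = gt
specialAns (fs f0) (fs f0) = gt
specialAns (fs f0) (fs (fs f0)) = gt
specialAns (fs f0) (fs (fs (fs f0))) = lt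
specialAns (fs (fs f0)) f0 = gt
specialAns (fs (fs f0)) (fs f0) = lt
specialAns (fs (fs f0)) (fs (fs f0)) = lt
specialAns (fs (fs f0)) (fs (fs (fs f0))) = lt
specialAns (fs (fs (fs f0))) f0 = gt
specialAns (fs (fs (fs f0))) (fs f0) = gt
specialAns (fs (fs (fs f0))) (fs (fs f0)) = lt
specialAns (fs (fs (fs f0))) (fs (fs (fs f0))) = lt

UnitAns : UType → Fin 4 → Ans → Set
UnitAns u1 f0 a = a ≡ lt
UnitAns u2 f0 a = a ≡ gt
UnitAns u2 (fs f0) a = a ≡ lt
UnitAns u3₁ f0 a = a ≡ gt
UnitAns u3₁ (fs f0) a = a ≡ lt
UnitAns u3₁ (fs (fs f0)) a = a ≡ lt
UnitAns u3₂ f0 a = a ≡ gt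
UnitAns u3₂ (fs f0) a = a ≡ gt
UnitAns u3₂ (fs (fs f0)) a = a ≡ lt
UnitAns u4g f0 a = a ≡ gt
UnitAns u4g (fs f0) a = a ≡ gt
UnitAns u4g (fs (fs f0)) a = a ≡ lt
UnitAns u4g (fs (fs (fs f0))) a = a ≡ lt
UnitAns u4s q a = ∃[ first ] (specialAns first q ≡ a)
UnitAns _ _ a = ⊥

-- RS₂ n k a : the strategy may answer a to the comparison x : a_k
RS₂ : ℕ → ℕ → Ans → Set
RS₂ n k a =
  ((16 * k ≤ n) × (a ≡ gt))
  ⊎ (∃[ f ] ∃[ τ ] ∃[ p ] (UnitHead n f × HeadType n f τ × (k ≡ elem f p) × UnitAns τ p a))

Essential : ℕ → ℕ → Set
Essential n m =
  ∃[ f ] (UnitHead n f × InUnitOf n f m ×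
    (∀ k → 1 ≤ k → k ≤ n → ¬ InUnitOf n f k →
       ∀ a → RS₂ n k a → ¬ Cuts k a m))

InE-pos : UType → Fin 4 → Set
InE-pos u1 f0 = ⊤
InE-pos u2 f0 = ⊤
InE-pos u2 (fs f0) = ⊤
InE-pos u3₁ f0 = ⊤
InE-pos u3₁ (fs f0) = ⊤
InE-pos u3₂ (fs f0) = ⊤
InE-pos u3₂ (fs (fs f0)) = ⊤
InE-pos u4g (fs f0) = ⊤
InE-pos u4g (fs (fs f0)) = ⊤
InE-pos u4s _ = ⊤
InE-pos _ _ = ⊥

E : ℕ → ℕ → Set
E n m = ∃[ f ] ∃[ τ ] ∃[ p ]
  (UnitHead n f × HeadType n f τ × (m ≡ elem f p) × (m ≤ n) × InE-pos τ p)

{-# OPTIONS --safe #-}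
-- If a_k cuts a_m then k = c·m (answer x > a_k) or m = c·k (answer x < a_k).
-- For c = 2 or 4 the two indices lie in one row of a layer, and a row holds a
-- single unit head, so a_k would lie in the unit of a_m.  For c = 3 or c ≥ 5
-- the answer bounds k against n: x > a_k forces 2k ≤ n, and x < a_k forces
-- n < 3k unless k = 4g with n < 18g.  Every m in E has n < 9m, and near the
-- top of the array its parity and divisibility by 3 are restricted (n < 6m if
-- m is odd; m is not 12g with n < 18g), which leaves no room for a cut.
module Submission where

open import Defs
open import Data.Nat using (ℕ; zero; suc; _+_; _*_; _^_; _≤_; _<_; _≤ᵇ_; >-nonZero)
open import Data.Nat.Properties
open import Data.Nat.Divisibility using (_∣_; divides; ∣-trans; m∣m*n; n∣m*n; ∣⇒≤)
open import Data.Nat.Coprimality using (coprime?; coprime-divisor)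
open import Algebra.Properties.CommutativeSemigroup *-commutativeSemigroup using (x∙yz≈y∙xz)
open import Data.Bool using (T)
open import Data.Fin using (Fin; toℕ) renaming (zero to f0; suc to fs)
open import Data.Product using (∃-syntax; _×_; _,_; proj₁)
open import Data.Sum using (_⊎_; inj₁; inj₂)
open import Data.Empty using (⊥; ⊥-elim)
open import Relation.Nullary using (¬_)
open import Relation.Nullary.Decidable using (True; toWitness)
open import Relation.Binary.PropositionalEquality

private
  variable
    n m k f g x : ℕ

-- The side conditions on the literals a, b compute to ⊤ and are filled in automatically.
scaled-absurd : ∀ a b x → a * x ≤ n → n < b * x → {T (b ≤ᵇ a)} → ⊥
scaled-absurd a b x ax≤n n<bx {b≤a} =
  <⇒≱ (<-≤-trans n<bx (*-monoˡ-≤ x (≤ᵇ⇒≤ b a b≤a))) ax≤n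

scaled-≤ : ∀ a b x → a * x ≤ n → {T (b ≤ᵇ a)} → b * x ≤ n
scaled-≤ a b x ax≤n {b≤a} = ≤-trans (*-monoˡ-≤ x (≤ᵇ⇒≤ b a b≤a)) ax≤n

scaled-< : ∀ a b x → n < a * x → {T (a ≤ᵇ b)} → n < b * x
scaled-< a b x n<ax {a≤b} = <-≤-trans n<ax (*-monoˡ-≤ x (≤ᵇ⇒≤ a b a≤b))

-- For literals a and c the coefficient a * c below computes to a literal.
rescale : ∀ a c x {y} → y ≡ c * x → a * y ≡ a * c * x
rescale a c x refl = sym (*-assoc a c x)

≤-rescale : ∀ a c x {y} → y ≡ c * x → a * c * x ≤ n → a * y ≤ n
≤-rescale {n} a c x y≡ = subst (_≤ n) (sym (rescale a c x y≡))

≤-unscale : ∀ a c x {y} → y ≡ c * x → a * y ≤ n → a * c * x ≤ n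
≤-unscale {n} a c x y≡ = subst (_≤ n) (rescale a c x y≡)

<-rescale : ∀ a c x {y} → y ≡ c * x → n < a * c * x → n < a * y
<-rescale {n} a c x y≡ = subst (n <_) (sym (rescale a c x y≡))

multiple-trans : ∀ c d z {y x} → y ≡ c * x → x ≡ d * z → y ≡ c * d * z
multiple-trans c d z y≡ refl = trans y≡ (rescale c d z refl)

elem-multiple : ∀ (p : Fin 4) → k ≡ elem f p → k ≡ 2 ^ toℕ p * f
elem-multiple {f = f} p k≡ = trans k≡ (*-comm f _)

3∣c*x⇒3∣x : ∀ c → {True (coprime? 3 c)} → 3 ∣ c * x → 3 ∣ x
3∣c*x⇒3∣x c {coprime} = coprime-divisor (toWitness coprime)

odd-head : UnitHead n f → n < 8 * f → Odd f
odd-head (_ , inj₁ odd) _ = odd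
odd-head (_ , inj₂ 8f≤n) n<8f = ⊥-elim (<⇒≱ n<8f 8f≤n)

no-unitHead-above-unitHead : ∀ b → UnitHead n f → UnitHead n g → f ≢ g * 2 ^ suc b
no-unitHead-above-unitHead {g = g} b (_ , inj₁ odd-f) _ f≡ =
  odd-f (subst (2 ∣_) (sym f≡) (∣-trans (m∣m*n (2 ^ b)) (n∣m*n g)))
no-unitHead-above-unitHead {f = f} {g} b (_ , inj₂ 8f≤n) ((_ , _ , n<16g) , _) f≡ =
  <⇒≱ n<16g (≤-trans 16g≤8f 8f≤n)
  where
  open ≤-Reasoning
  16g≤8f : 16 * g ≤ 8 * f
  16g≤8f = begin
    16 * g                ≤⟨ *-monoʳ-≤ 16 (m≤m*n g (2 ^ b) {{m^n≢0 2 b}}) ⟩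
    16 * (g * 2 ^ b)      ≡⟨ *-assoc 8 2 (g * 2 ^ b) ⟩
    8 * (2 * (g * 2 ^ b)) ≡⟨ cong (8 *_) (x∙yz≈y∙xz 2 g (2 ^ b)) ⟩
    8 * (g * 2 ^ suc b)   ≡⟨ cong (8 *_) f≡ ⟨
    8 * f                 ∎

unitHead-unique : UnitHead n f → UnitHead n g → ∀ a b → f * 2 ^ a ≡ g * 2 ^ b → f ≡ g
unitHead-unique {f = f} {g} _ _ zero zero e = trans (sym (*-identityʳ f)) (trans e (*-identityʳ g))
unitHead-unique {f = f} {g} uf ug (suc a) (suc b) e =
  unitHead-unique uf ug a b (*-cancelˡ-≡ _ _ 2 (begin
    2 * (f * 2 ^ a)  ≡⟨ x∙yz≈y∙xz 2 f (2 ^ a) ⟩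
    f * 2 ^ suc a    ≡⟨ e ⟩
    g * 2 ^ suc b    ≡⟨ x∙yz≈y∙xz 2 g (2 ^ b) ⟨
    2 * (g * 2 ^ b)  ∎))
  where open ≡-Reasoning
unitHead-unique {f = f} uf ug zero (suc b) e =
  ⊥-elim (no-unitHead-above-unitHead b uf ug (trans (sym (*-identityʳ f)) e))
unitHead-unique {g = g} uf ug (suc a) zero e =
  ⊥-elim (no-unitHead-above-unitHead a ug uf (trans (sym (*-identityʳ g)) (sym e)))

row-shift : ∀ j x p → 2 ^ j * (x * 2 ^ p) ≡ x * 2 ^ (j + p)
row-shift j x p = trans (x∙yz≈y∙xz (2 ^ j) x (2 ^ p)) (cong (x *_) (sym (^-distribˡ-+-* 2 j p)))

row-mate-in-unit : ∀ {p q} j → UnitHead n f → m ≡ elem f p →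
                   UnitHead n g → k ≡ elem g q → k ≤ n →
                   k ≡ 2 ^ j * m ⊎ m ≡ 2 ^ j * k → InUnitOf n f k
row-mate-in-unit {f = f} {m} {g} {k} {p} {q} j uf m≡ ug k≡ k≤n related =
  k≤n , q , subst (λ h → k ≡ elem h q) (sym (same-head related)) k≡
  where
  open ≡-Reasoning
  same-head : k ≡ 2 ^ j * m ⊎ m ≡ 2 ^ j * k → f ≡ g
  same-head (inj₁ k≡2ʲm) = unitHead-unique uf ug (j + toℕ p) (toℕ q) (begin
    f * 2 ^ (j + toℕ p)     ≡⟨ row-shift j f (toℕ p) ⟨
    2 ^ j * (f * 2 ^ toℕ p) ≡⟨ cong (2 ^ j *_) m≡ ⟨
    2 ^ j * m               ≡⟨ k≡2ʲm ⟨
    k                       ≡⟨ k≡ ⟩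
    g * 2 ^ toℕ q           ∎)
  same-head (inj₂ m≡2ʲk) = unitHead-unique uf ug (toℕ p) (j + toℕ q) (begin
    f * 2 ^ toℕ p           ≡⟨ m≡ ⟨
    m                       ≡⟨ m≡2ʲk ⟩
    2 ^ j * k               ≡⟨ cong (2 ^ j *_) k≡ ⟩
    2 ^ j * (g * 2 ^ toℕ q) ≡⟨ row-shift j g (toℕ q) ⟩
    g * 2 ^ (j + toℕ q)     ∎)

answered-in-unit : ∀ {a} → RS₂ n k a → (16 * k ≤ n → a ≢ gt) →
                   ∃[ g ] ∃[ q ] (UnitHead n g × k ≡ elem g q)
answered-in-unit (inj₁ (16k≤n , a≡gt)) not-outside = ⊥-elim (not-outside 16k≤n a≡gt)
answered-in-unit (inj₂ (g , _ , q , ug , _ , k≡ , _)) _ = g , q , ug , k≡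

data EShape (n m : ℕ) : Set where
  inner-small    : 2 * m ≤ n → n < 6 * m → EShape n m
  inner-even     : 2 ∣ m → 2 * m ≤ n → n < 9 * m → EShape n m
  last-odd       : Odd m → n < 2 * m → EShape n m
  last-twice-odd : ∀ o → Odd o → m ≡ 2 * o → n < 2 * m → EShape n m
  last-quadruple : ∀ x → m ≡ 4 * x → 6 * x ≤ n → n < 2 * m → EShape n m
  last-special   : ∀ i → ¬ 3 ∣ i → m ≡ 16 * i → n < 2 * m → EShape n m

unit-shape : ∀ τ p → UnitHead n f → HeadType n f τ → m ≡ 2 ^ toℕ p * f → InE-pos τ p → EShape n m
unit-shape {f = f} u1 f0 uf n<2f m≡ _ =
  last-odd (subst Odd (sym (trans m≡ (*-identityˡ f))) (odd-head uf (scaled-< 2 8 f n<2f)))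
           (<-rescale 2 1 f m≡ n<2f)
unit-shape {f = f} u2 f0 _ (2f≤n , n<4f) m≡ _ =
  inner-small (≤-rescale 2 1 f m≡ 2f≤n) (<-rescale 6 1 f m≡ (scaled-< 4 6 f n<4f))
unit-shape {f = f} u2 (fs f0) uf (_ , n<4f) m≡ _ =
  last-twice-odd f (odd-head uf (scaled-< 4 8 f n<4f)) m≡ (<-rescale 2 2 f m≡ n<4f)
unit-shape {f = f} u3₁ f0 _ (4f≤n , _ , _ , n<6f) m≡ _ =
  inner-small (≤-rescale 2 1 f m≡ (scaled-≤ 4 2 f 4f≤n)) (<-rescale 6 1 f m≡ n<6f)
unit-shape {f = f} u3₁ (fs f0) _ (4f≤n , _ , _ , n<6f) m≡ _ =
  inner-small (≤-rescale 2 2 f m≡ 4f≤n) (<-rescale 6 2 f m≡ (scaled-< 6 12 f n<6f))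
unit-shape {f = f} u3₂ (fs f0) _ (4f≤n , _ , _ , n<12f) m≡ _ =
  inner-small (≤-rescale 2 2 f m≡ 4f≤n) (<-rescale 6 2 f m≡ n<12f)
unit-shape {f = f} u3₂ (fs (fs f0)) _ (_ , n<8f , 6f≤n , _) m≡ _ =
  last-quadruple f m≡ 6f≤n (<-rescale 2 4 f m≡ n<8f)
unit-shape {f = f} u4g (fs f0) ((_ , _ , n<16f) , _) (8f≤n , _) m≡ _ =
  inner-even (subst (2 ∣_) (sym m≡) (m∣m*n f))
             (≤-rescale 2 2 f m≡ (scaled-≤ 8 4 f 8f≤n)) (<-rescale 9 2 f m≡ (scaled-< 16 18 f n<16f))
unit-shape {f = f} u4g (fs (fs f0)) ((_ , _ , n<16f) , _) (8f≤n , _) m≡ _ =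
  inner-small (≤-rescale 2 4 f m≡ 8f≤n) (<-rescale 6 4 f m≡ (scaled-< 16 24 f n<16f))
unit-shape {m = m} u4s f0 _ (_ , i , f≡ , _ , _ , n<18i , 16i≤n) m≡ _ =
  inner-even (subst (2 ∣_) (sym m≡i) (m∣m*n i))
             (≤-rescale 2 2 i m≡i (scaled-≤ 16 4 i 16i≤n)) (<-rescale 9 2 i m≡i n<18i)
  where
  m≡i : m ≡ 2 * i
  m≡i = multiple-trans 1 2 i m≡ f≡
unit-shape {m = m} u4s (fs f0) _ (_ , i , f≡ , _ , _ , n<18i , 16i≤n) m≡ _ =
  inner-small (≤-rescale 2 4 i m≡i (scaled-≤ 16 8 i 16i≤n))
              (<-rescale 6 4 i m≡i (scaled-< 18 24 i n<18i))
  where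
  m≡i : m ≡ 4 * i
  m≡i = multiple-trans 2 2 i m≡ f≡
unit-shape {m = m} u4s (fs (fs f0)) _ (_ , i , f≡ , _ , _ , n<18i , 16i≤n) m≡ _ =
  inner-small (≤-rescale 2 8 i m≡i 16i≤n) (<-rescale 6 8 i m≡i (scaled-< 18 48 i n<18i))
  where
  m≡i : m ≡ 8 * i
  m≡i = multiple-trans 4 2 i m≡ f≡
unit-shape {m = m} u4s (fs (fs (fs f0))) _ (_ , i , f≡ , _ , ¬3∣i , n<18i , _) m≡ _ =
  last-special i ¬3∣i m≡i (<-rescale 2 16 i m≡i (scaled-< 18 32 i n<18i))
  where
  m≡i : m ≡ 16 * i
  m≡i = multiple-trans 8 2 i m≡ f≡
unit-shape u1  (fs _)             _ _ _ ()
unit-shape u2  (fs (fs _))        _ _ _ ()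
unit-shape u3₁ (fs (fs _))        _ _ _ ()
unit-shape u3₂ f0                 _ _ _ ()
unit-shape u3₂ (fs (fs (fs _)))   _ _ _ ()
unit-shape u4g f0                 _ _ _ ()
unit-shape u4g (fs (fs (fs _)))   _ _ _ ()

E-shape : E n m → EShape n m
E-shape (_ , τ , p , uf , ht , m≡ , _ , pos) = unit-shape τ p uf ht (elem-multiple p m≡) pos

E⇒n<9m : E n m → n < 9 * m
E⇒n<9m {m = m} m∈E with E-shape m∈E
... | inner-small _ n<6m             = scaled-< 6 9 m n<6m
... | inner-even _ _ n<9m            = n<9m
... | last-odd _ n<2m                = scaled-< 2 9 m n<2m
... | last-twice-odd _ _ _ n<2m      = scaled-< 2 9 m n<2m
... | last-quadruple _ _ _ n<2m      = scaled-< 2 9 m n<2m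
... | last-special _ _ _ n<2m        = scaled-< 2 9 m n<2m

E-odd⇒n<6m : E n m → Odd m → n < 6 * m
E-odd⇒n<6m {m = m} m∈E odd with E-shape m∈E
... | inner-small _ n<6m             = n<6m
... | inner-even 2∣m _ _             = ⊥-elim (odd 2∣m)
... | last-odd _ n<2m                = scaled-< 2 6 m n<2m
... | last-twice-odd _ _ _ n<2m      = scaled-< 2 6 m n<2m
... | last-quadruple _ _ _ n<2m      = scaled-< 2 6 m n<2m
... | last-special _ _ _ n<2m        = scaled-< 2 6 m n<2m

-- The only elements of E with 2n < 3m are odd, twice an odd number, or 16i with 3 ∤ i.
E-twelvefold-absurd : E n (12 * g) → n < 18 * g → ⊥
E-twelvefold-absurd {g = g} 12g∈E n<18g with E-shape 12g∈E
... | inner-small 2m≤n _ = scaled-absurd 24 18 g (≤-unscale 2 12 g refl 2m≤n) n<18g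
... | inner-even _ 2m≤n _ = scaled-absurd 24 18 g (≤-unscale 2 12 g refl 2m≤n) n<18g
... | last-odd odd _ = odd (∣-trans (divides 6 refl) (m∣m*n g))
... | last-twice-odd o odd-o m≡2o _ =
  odd-o (subst (2 ∣_) (sym o≡6g) (∣-trans (divides 3 refl) (m∣m*n g)))
  where
  o≡6g : o ≡ 6 * g
  o≡6g = *-cancelˡ-≡ o (6 * g) 2 (trans (sym m≡2o) (sym (rescale 2 6 g refl)))
... | last-quadruple x m≡4x 6x≤n _ = scaled-absurd 18 18 g (≤-unscale 6 3 g x≡3g 6x≤n) n<18g
  where
  x≡3g : x ≡ 3 * g
  x≡3g = *-cancelˡ-≡ x (3 * g) 4 (trans (sym m≡4x) (sym (rescale 4 3 g refl)))
... | last-special i ¬3∣i m≡16i _ = ¬3∣i (3∣c*x⇒3∣x 16 (divides (4 * g) (begin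
  16 * i      ≡⟨ m≡16i ⟨
  12 * g      ≡⟨ rescale 3 4 g refl ⟨
  3 * (4 * g) ≡⟨ *-comm 3 (4 * g) ⟩
  4 * g * 3   ∎)))
  where open ≡-Reasoning

data GtProfile (n k : ℕ) : Set where
  odd-double≤   : Odd k → 2 * k ≤ n → GtProfile n k
  triple≤       : 3 * k ≤ n → GtProfile n k
  special-third : ∀ i → k ≡ 8 * i → 16 * i ≤ n → ¬ 3 ∣ i → GtProfile n k

gt-profile : RS₂ n k gt → GtProfile n k
gt-profile {k = k} (inj₁ (16k≤n , _)) = triple≤ (scaled-≤ 16 3 k 16k≤n)
gt-profile (inj₂ (g , τ , q , ug , ht , k≡ , ans)) = unit-gt τ q ug ht (elem-multiple q k≡) ans
  where
  unit-gt : ∀ τ q → UnitHead n g → HeadType n g τ → k ≡ 2 ^ toℕ q * g →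
            UnitAns τ q gt → GtProfile n k
  unit-gt u2 f0 ug (2g≤n , n<4g) k≡ _ =
    odd-double≤ (subst Odd (sym (trans k≡ (*-identityˡ g))) (odd-head ug (scaled-< 4 8 g n<4g)))
                (≤-rescale 2 1 g k≡ 2g≤n)
  unit-gt u3₁ f0 _ (4g≤n , _) k≡ _ = triple≤ (≤-rescale 3 1 g k≡ (scaled-≤ 4 3 g 4g≤n))
  unit-gt u3₂ f0 _ (4g≤n , _) k≡ _ = triple≤ (≤-rescale 3 1 g k≡ (scaled-≤ 4 3 g 4g≤n))
  unit-gt u3₂ (fs f0) _ (_ , _ , 6g≤n , _) k≡ _ = triple≤ (≤-rescale 3 2 g k≡ 6g≤n)
  unit-gt u4g f0 _ (8g≤n , _) k≡ _ = triple≤ (≤-rescale 3 1 g k≡ (scaled-≤ 8 3 g 8g≤n))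
  unit-gt u4g (fs f0) _ (8g≤n , _) k≡ _ = triple≤ (≤-rescale 3 2 g k≡ (scaled-≤ 8 6 g 8g≤n))
  unit-gt u4s f0 _ (8g≤n , _) k≡ _ = triple≤ (≤-rescale 3 1 g k≡ (scaled-≤ 8 3 g 8g≤n))
  unit-gt u4s (fs f0) _ (8g≤n , _) k≡ _ = triple≤ (≤-rescale 3 2 g k≡ (scaled-≤ 8 6 g 8g≤n))
  unit-gt u4s (fs (fs f0)) _ (_ , i , g≡ , _ , ¬3∣i , _ , 16i≤n) k≡ _ =
    special-third i (multiple-trans 4 2 i k≡ g≡) 16i≤n ¬3∣i
  unit-gt u1 f0 _ _ _ ()
  unit-gt u2 (fs f0) _ _ _ ()
  unit-gt u3₁ (fs f0) _ _ _ ()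
  unit-gt u3₁ (fs (fs f0)) _ _ _ ()
  unit-gt u3₂ (fs (fs f0)) _ _ _ ()
  unit-gt u4g (fs (fs f0)) _ _ _ ()
  unit-gt u4g (fs (fs (fs f0))) _ _ _ ()
  unit-gt u4s (fs (fs (fs f0))) _ _ _ (f0 , ())
  unit-gt u4s (fs (fs (fs f0))) _ _ _ (fs f0 , ())
  unit-gt u4s (fs (fs (fs f0))) _ _ _ (fs (fs f0) , ())
  unit-gt u4s (fs (fs (fs f0))) _ _ _ (fs (fs (fs f0)) , ())
  unit-gt u1 (fs _) _ _ _ ()
  unit-gt u2 (fs (fs _)) _ _ _ ()
  unit-gt u3₁ (fs (fs (fs _))) _ _ _ ()
  unit-gt u3₂ (fs (fs (fs _))) _ _ _ ()

gt⇒2k≤n : RS₂ n k gt → 2 * k ≤ n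
gt⇒2k≤n {k = k} gt-ok with gt-profile gt-ok
... | odd-double≤ _ 2k≤n        = 2k≤n
... | triple≤ 3k≤n              = scaled-≤ 3 2 k 3k≤n
... | special-third i k≡ 16i≤n _ = ≤-rescale 2 8 i k≡ 16i≤n

data LtProfile (n k : ℕ) : Set where
  triple>    : n < 3 * k → LtProfile n k
  quadruple  : ∀ g → k ≡ 4 * g → n < 18 * g → LtProfile n k

lt-profile : RS₂ n k lt → LtProfile n k
lt-profile (inj₁ (_ , ()))
lt-profile (inj₂ (g , τ , q , ug , ht , k≡ , ans)) = unit-lt τ q ug ht (elem-multiple q k≡) ans
  where
  unit-lt : ∀ τ q → UnitHead n g → HeadType n g τ → k ≡ 2 ^ toℕ q * g →
            UnitAns τ q lt → LtProfile n k
  unit-lt u1 f0 _ n<2g k≡ _ = triple> (<-rescale 3 1 g k≡ (scaled-< 2 3 g n<2g))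
  unit-lt u2 (fs f0) _ (_ , n<4g) k≡ _ = triple> (<-rescale 3 2 g k≡ (scaled-< 4 6 g n<4g))
  unit-lt u3₁ (fs f0) _ (_ , _ , _ , n<6g) k≡ _ = triple> (<-rescale 3 2 g k≡ n<6g)
  unit-lt u3₁ (fs (fs f0)) _ (_ , n<8g , _) k≡ _ = triple> (<-rescale 3 4 g k≡ (scaled-< 8 12 g n<8g))
  unit-lt u3₂ (fs (fs f0)) _ (_ , n<8g , _) k≡ _ = triple> (<-rescale 3 4 g k≡ (scaled-< 8 12 g n<8g))
  unit-lt u4g (fs (fs f0)) ((_ , _ , n<16g) , _) _ k≡ _ = quadruple g k≡ (scaled-< 16 18 g n<16g)
  unit-lt u4g (fs (fs (fs f0))) ((_ , _ , n<16g) , _) _ k≡ _ =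
    triple> (<-rescale 3 8 g k≡ (scaled-< 16 24 g n<16g))
  unit-lt u4s (fs f0) _ (_ , i , g≡ , _ , _ , n<18i , _) k≡ _ =
    quadruple i (multiple-trans 2 2 i k≡ g≡) n<18i
  unit-lt u4s (fs (fs f0)) _ (_ , i , g≡ , _ , _ , n<18i , _) k≡ _ =
    triple> (<-rescale 3 8 i (multiple-trans 4 2 i k≡ g≡) (scaled-< 18 24 i n<18i))
  unit-lt u4s (fs (fs (fs f0))) ((_ , _ , n<16g) , _) _ k≡ _ =
    triple> (<-rescale 3 8 g k≡ (scaled-< 16 24 g n<16g))
  unit-lt u2 f0 _ _ _ ()
  unit-lt u3₁ f0 _ _ _ ()
  unit-lt u3₂ f0 _ _ _ ()
  unit-lt u3₂ (fs f0) _ _ _ ()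
  unit-lt u4g f0 _ _ _ ()
  unit-lt u4g (fs f0) _ _ _ ()
  unit-lt u4s f0 _ _ _ (f0 , ())
  unit-lt u4s f0 _ _ _ (fs f0 , ())
  unit-lt u4s f0 _ _ _ (fs (fs f0) , ())
  unit-lt u4s f0 _ _ _ (fs (fs (fs f0)) , ())
  unit-lt u1 (fs _) _ _ _ ()
  unit-lt u2 (fs (fs _)) _ _ _ ()
  unit-lt u3₁ (fs (fs (fs _))) _ _ _ ()
  unit-lt u3₂ (fs (fs (fs _))) _ _ _ ()

lt⇒n<5k : RS₂ n k lt → n < 5 * k
lt⇒n<5k {k = k} lt-ok with lt-profile lt-ok
... | triple> n<3k          = scaled-< 3 5 k n<3k
... | quadruple g k≡ n<18g  = <-rescale 5 4 g k≡ (scaled-< 18 20 g n<18g)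

¬gt-at-triple : E n m → ¬ RS₂ n (3 * m) gt
¬gt-at-triple {m = m} m∈E gt-ok with gt-profile gt-ok
... | odd-double≤ odd-3m 6m≤n =
  <⇒≱ (E-odd⇒n<6m m∈E (λ 2∣m → odd-3m (∣-trans 2∣m (n∣m*n 3)))) (≤-unscale 2 3 m refl 6m≤n)
... | triple≤ 9m≤n = <⇒≱ (E⇒n<9m m∈E) (≤-unscale 3 3 m refl 9m≤n)
... | special-third i 3m≡8i _ ¬3∣i = ¬3∣i (3∣c*x⇒3∣x 8 (divides m (trans (sym 3m≡8i) (*-comm 3 m))))

¬lt-at-third : E n (3 * k) → ¬ RS₂ n k lt
¬lt-at-third 3k∈E@(_ , _ , _ , _ , _ , _ , 3k≤n , _) lt-ok with lt-profile lt-ok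
... | triple> n<3k = <⇒≱ n<3k 3k≤n
... | quadruple g k≡4g n<18g =
  E-twelvefold-absurd {g = g} (subst (E _) (multiple-trans 3 4 g refl k≡4g) 3k∈E) n<18g

gt-never-cuts : (m∈E : E n m) → 1 ≤ k → k ≤ n → ¬ InUnitOf n (proj₁ m∈E) k →
                RS₂ n k gt → ¬ Cuts k gt m
gt-never-cuts {n} {m} {k} m∈E@(_ , _ , p , uf , _ , m≡ , _) 1≤k k≤n k∉unit gt-ok
              (m∣k@(divides c k≡cm) , m≢k) = by-quotient c k≡cm
  where
  n<16k : n < 16 * k
  n<16k = <-≤-trans (scaled-< 9 16 m (E⇒n<9m m∈E)) (*-monoʳ-≤ 16 (∣⇒≤ {{>-nonZero 1≤k}} m∣k))

  row-mate : ∀ j → k ≡ 2 ^ j * m → ⊥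
  row-mate j k≡2ʲm =
    let g , q , ug , k≡ = answered-in-unit gt-ok (λ 16k≤n _ → <⇒≱ n<16k 16k≤n)
    in k∉unit (row-mate-in-unit {p = p} {q = q} j uf m≡ ug k≡ k≤n (inj₁ k≡2ʲm))

  by-quotient : ∀ c → k ≡ c * m → ⊥
  by-quotient 0 k≡0 = <⇒≱ 1≤k (≤-reflexive k≡0)
  by-quotient 1 k≡1m = m≢k (sym (trans k≡1m (*-identityˡ m)))
  by-quotient 2 = row-mate 1
  by-quotient 3 k≡3m = ¬gt-at-triple m∈E (subst (λ k → RS₂ n k gt) k≡3m gt-ok)
  by-quotient 4 = row-mate 2
  by-quotient (suc (suc (suc (suc (suc c))))) k≡cm = scaled-absurd 10 9 m 10m≤n (E⇒n<9m m∈E)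
    where
    5m≤k : 5 * m ≤ k
    5m≤k = ≤-trans (*-monoˡ-≤ m (m≤m+n 5 c)) (≤-reflexive (sym k≡cm))
    10m≤n : 10 * m ≤ n
    10m≤n = ≤-unscale 2 5 m refl (≤-trans (*-monoʳ-≤ 2 5m≤k) (gt⇒2k≤n gt-ok))

lt-never-cuts : (m∈E : E n m) → k ≤ n → ¬ InUnitOf n (proj₁ m∈E) k →
                RS₂ n k lt → ¬ Cuts k lt m
lt-never-cuts {n} {m} {k} m∈E@(_ , _ , p , uf , _ , m≡ , m≤n , _) k≤n k∉unit lt-ok
              (divides c m≡ck , m≢k) = by-quotient c m≡ck
  where
  row-mate : ∀ j → m ≡ 2 ^ j * k → ⊥
  row-mate j m≡2ʲk =
    let g , q , ug , k≡ = answered-in-unit lt-ok (λ _ ())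
    in k∉unit (row-mate-in-unit {p = p} {q = q} j uf m≡ ug k≡ k≤n (inj₂ m≡2ʲk))

  by-quotient : ∀ c → m ≡ c * k → ⊥
  by-quotient 0 m≡0 = n≮0 (subst (λ m → n < 9 * m) m≡0 (E⇒n<9m m∈E))
  by-quotient 1 m≡1k = m≢k (trans m≡1k (*-identityˡ k))
  by-quotient 2 = row-mate 1
  by-quotient 3 m≡3k = ¬lt-at-third (subst (E n) m≡3k m∈E) lt-ok
  by-quotient 4 = row-mate 2
  by-quotient (suc (suc (suc (suc (suc c))))) m≡ck = <⇒≱ (lt⇒n<5k lt-ok) 5k≤n
    where
    5k≤n : 5 * k ≤ n
    5k≤n = ≤-trans (*-monoˡ-≤ k (m≤m+n 5 c)) (≤-trans (≤-reflexive (sym m≡ck)) m≤n)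

lemma5p1 : ∀ (n : ℕ) → 1 ≤ n → ∀ (m : ℕ) → E n m → Essential n m
lemma5p1 n _ m m∈E@(f , _ , p , uf , _ , m≡ , m≤n , _) = f , uf , (m≤n , p , m≡) , no-cut
  where
  no-cut : ∀ k → 1 ≤ k → k ≤ n → ¬ InUnitOf n f k → ∀ a → RS₂ n k a → ¬ Cuts k a m
  no-cut k _   k≤n k∉unit lt = lt-never-cuts m∈E k≤n k∉unit
  no-cut k _   _   _      eq = λ _ ()
  no-cut k 1≤k k≤n k∉unit gt = gt-never-cuts m∈E 1≤k k≤n k∉unit
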